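{- For each integer $m\geq 1$, the partitions $\lambda$ of $2m$ with cyclicity index $c(\lambda)=0$ are in bijective correspondence with the partitions of $m$ into triangular numbers (i.e. multisets of numbers of the form $i(i+1)/2$, $i\geq 1$, summing to $m$).
   Context: A partition of a positive integer $n$ is a tuple $\lambda=(n_1,n_2,\dots,n_r)$ of positive integers with $n_1\geq n_2\geq\dots\geq n_r$ and $n_1+\dots+n_r=n$. The cyclicity index of $\lambda$ is $c(\lambda)=\sum_{i=1}^r(3-2i)n_i$. The triangular numbers are the numbers $i(i+1)/2$ for integers $i\geq 1$. -}

module Defs where

open import Data.Nat using (ℕ; zero; suc; _+_; _*_; _≤_; _≥_)
open import Data.Nat.DivMod using (_/_)
open import Data.Integer as ℤ using (ℤ; +_)
open import Data.List using (List; []; _∷_)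
open import Data.Nat.ListAction using (sum)
open import Data.List.Relation.Unary.All using (All)
open import Data.List.Relation.Unary.Linked using (Linked)
open import Data.Product using (_×_; ∃-syntax; Σ)
open import Relation.Binary.PropositionalEquality using (_≡_)

IsPartition : ℕ → List ℕ → Set
IsPartition n ps = All (λ x → 1 ≤ x) ps × Linked _≥_ ps × sum ps ≡ n

Partition : ℕ → Set
Partition n = Σ (List ℕ) (IsPartition n)

cycAux : ℕ → List ℕ → ℤ
cycAux i []       = + 0
cycAux i (x ∷ xs) = ((+ 3 ℤ.- + (2 * i)) ℤ.* + x) ℤ.+ cycAux (suc i) xs

-- Cyclicity index c(λ) = Σ_{i=1}^r (3 - 2i) n_i  (indices start at 1).
cyclicity : List ℕ → ℤ
cyclicity ps = cycAux 1 ps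

Triangular : ℕ → Set
Triangular x = ∃[ i ] (1 ≤ i × x ≡ (i * suc i) / 2)

ZeroCyclicityPartition : ℕ → Set
ZeroCyclicityPartition n = Σ (List ℕ) (λ ps → IsPartition n ps × cyclicity ps ≡ + 0)

-- Partitions of m into triangular numbers (multisets represented as
-- weakly decreasing lists).
TriangularPartition : ℕ → Set
TriangularPartition m = Σ (List ℕ) (λ ps → IsPartition m ps × All Triangular ps)

-- Write λ = (n₁, μ) with μ = (n₂, …, n_r). Then c(λ) = 0 says n₁ = Σ_{k≥1} (2k − 1) μ_k,
-- so |λ| = 2 Σ_{k≥1} k μ_k and λ ↦ μ identifies the partitions in question with the
-- partitions μ satisfying Σ_k k μ_k = m (the condition n₁ ≥ n₂ holds automatically).
-- Writing μ through its column lengths, i.e. its conjugate μ′, Abel summation gives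
-- Σ_k k μ_k = Σ_j T(μ′_j) with T(i) = i(i+1)/2, so μ ↦ μ′ followed by i ↦ T(i) lands
-- exactly on the partitions of m into triangular numbers. The conjugate is computed via
-- the difference sequence e_k = μ_k − μ_{k+1}, which is the multiplicity vector of μ′.
module Submission where

open import Defs
open import Axiom.UniquenessOfIdentityProofs using (module Decidable⇒UIP)
open import Data.Empty using (⊥-elim)
open import Data.Integer as ℤ using (ℤ)
import Data.Integer.Properties as ℤP
open import Data.Integer.Tactic.RingSolver as ℤSolver using ()
open import Data.List using (List; []; _∷_; _++_; [_]; map; length; drop)
open import Data.List.Properties using (map-++; map-∘)
open import Data.List.Relation.Unary.All as All using (All; []; _∷_)
import Data.List.Relation.Unary.All.Properties as All
open import Data.List.Relation.Unary.Linked as Linked using (Linked; []; [-]; _∷_)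
import Data.List.Relation.Unary.Linked.Properties as Linked
open import Data.Nat using (ℕ; zero; suc; pred; _+_; _*_; _∸_; _≤_; _<_; _≥_; z≤n; s≤s; z<s)
open import Data.Nat.DivMod using (_/_; +-distrib-/-∣ʳ; m*n/n≡m)
open import Data.Nat.Divisibility using (divides)
open import Data.Nat.ListAction using (sum)
open import Data.Nat.ListAction.Properties using (sum-++)
open import Data.Nat.Properties
open import Data.Nat.Tactic.RingSolver using (solve-∀)
open import Data.Product using (Σ; _×_; _,_; proj₁; proj₂)
open import Data.Sum using (inj₁; inj₂)
open import Data.Unit using (⊤; tt)
open import Function using (_∘_)
open import Function.Bundles using (_↔_; mk↔ₛ′)
open import Function.Properties.Inverse using (↔-trans)
open import Relation.Nullary using (Irrelevant)
open import Relation.Binary.PropositionalEquality hiding ([_])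

×-irrelevant : ∀ {A B : Set} → Irrelevant A → Irrelevant B → Irrelevant (A × B)
×-irrelevant irrA irrB (a , b) (a′ , b′) = cong₂ _,_ (irrA a a′) (irrB b b′)

Σ-≡-irrelevant : ∀ {A : Set} {P : A → Set} → (∀ {x} → Irrelevant (P x)) →
                 ∀ {x y} {p : P x} {q : P y} → x ≡ y → (x , p) ≡ (y , q)
Σ-≡-irrelevant irr refl = cong (_ ,_) (irr _ _)

subtype-↔ : ∀ {A B : Set} {P : A → Set} {Q : B → Set} →
            (∀ {x} → Irrelevant (P x)) → (∀ {y} → Irrelevant (Q y)) →
            (f : A → B) (g : ∀ y → Q y → A)
            (f-pres : ∀ x → P x → Q (f x)) (g-pres : ∀ y (q : Q y) → P (g y q)) →
            (∀ y (q : Q y) → f (g y q) ≡ y) →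
            (∀ x (p : P x) → g (f x) (f-pres x p) ≡ x) →
            Σ A P ↔ Σ B Q
subtype-↔ irrP irrQ f g f-pres g-pres f∘g g∘f =
  mk↔ₛ′ (λ (x , p) → f x , f-pres x p) (λ (y , q) → g y q , g-pres y q)
        (λ (y , q) → Σ-≡-irrelevant irrQ (f∘g y q)) (λ (x , p) → Σ-≡-irrelevant irrP (g∘f x p))

Positive : List ℕ → Set
Positive = All (1 ≤_)

Descending : List ℕ → Set
Descending = Linked _≥_

Positive-irrelevant : ∀ {xs} → Irrelevant (Positive xs)
Positive-irrelevant = All.irrelevant ≤-irrelevant

Descending-irrelevant : ∀ {xs} → Irrelevant (Descending xs)
Descending-irrelevant = Linked.irrelevant ≤-irrelevant

IsPartitionWith : (List ℕ → ℕ) → ℕ → List ℕ → Set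
IsPartitionWith σ m xs = Positive xs × Descending xs × σ xs ≡ m

IsPartitionWith-irrelevant : ∀ σ {m xs} → Irrelevant (IsPartitionWith σ m xs)
IsPartitionWith-irrelevant _ = ×-irrelevant Positive-irrelevant (×-irrelevant Descending-irrelevant ≡-irrelevant)

tri : ℕ → ℕ
tri i = (i * suc i) / 2

tri-suc : ∀ i → tri (suc i) ≡ tri i + suc i
tri-suc i = begin
  (suc i * suc (suc i)) / 2   ≡⟨ cong (_/ 2) (expand i) ⟩
  (i * suc i + suc i * 2) / 2 ≡⟨ +-distrib-/-∣ʳ (i * suc i) (divides (suc i) refl) ⟩
  tri i + suc i * 2 / 2       ≡⟨ cong (tri i +_) (m*n/n≡m (suc i) 2) ⟩
  tri i + suc i               ∎
  where
  open ≡-Reasoning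
  expand : ∀ i → (1 + i) * (2 + i) ≡ i * (1 + i) + (1 + i) * 2
  expand = solve-∀

tri-<-suc : ∀ i → tri i < tri (suc i)
tri-<-suc i = subst (tri i <_) (sym (tri-suc i)) (m<m+n (tri i) z<s)

tri-< : ∀ {i j} → i < j → tri i < tri j
tri-< {i} {suc j} (s≤s i≤j) with m≤n⇒m<n∨m≡n i≤j
... | inj₁ i<j  = <-trans (tri-< i<j) (tri-<-suc j)
... | inj₂ refl = tri-<-suc i

tri-mono-≤ : ∀ {i j} → i ≤ j → tri i ≤ tri j
tri-mono-≤ i≤j with m≤n⇒m<n∨m≡n i≤j
... | inj₁ i<j  = <⇒≤ (tri-< i<j)
... | inj₂ refl = ≤-refl

tri-cancel-≤ : ∀ {i j} → tri i ≤ tri j → i ≤ j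
tri-cancel-≤ le = ≮⇒≥ (λ j<i → <⇒≱ (tri-< j<i) le)

tri-injective : ∀ {i j} → tri i ≡ tri j → i ≡ j
tri-injective e = ≤-antisym (tri-cancel-≤ (≤-reflexive e)) (tri-cancel-≤ (≤-reflexive (sym e)))

Triangular-irrelevant : ∀ {x} → Irrelevant (Triangular x)
Triangular-irrelevant (i , p , e) (j , p′ , e′) with tri-injective {i} {j} (trans (sym e) e′)
... | refl = cong₂ (λ a b → i , a , b) (≤-irrelevant p p′) (≡-irrelevant e e′)

-- Positions are counted from 0, so weightedSum suc μ is the paper's Σ_k k μ_k.
weightedSum : (ℕ → ℕ) → List ℕ → ℕ
weightedSum w []       = 0
weightedSum w (x ∷ xs) = x * w 0 + weightedSum (w ∘ suc) xs

weightedSum-cong : ∀ {v w} → (∀ j → v j ≡ w j) → ∀ xs → weightedSum v xs ≡ weightedSum w xs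
weightedSum-cong v≗w []       = refl
weightedSum-cong v≗w (x ∷ xs) = cong₂ (λ a b → x * a + b) (v≗w 0) (weightedSum-cong (v≗w ∘ suc) xs)

weightedSum-mono-≤ : ∀ {v w} → (∀ j → v j ≤ w j) → ∀ xs → weightedSum v xs ≤ weightedSum w xs
weightedSum-mono-≤ v≤w []       = z≤n
weightedSum-mono-≤ v≤w (x ∷ xs) = +-mono-≤ (*-monoʳ-≤ x (v≤w 0)) (weightedSum-mono-≤ (v≤w ∘ suc) xs)

weightedSum-+ : ∀ v w xs → weightedSum v xs + weightedSum w xs ≡ weightedSum (λ j → v j + w j) xs
weightedSum-+ v w []       = refl
weightedSum-+ v w (x ∷ xs) =
  trans (rearrange x (v 0) (w 0) (weightedSum (v ∘ suc) xs) (weightedSum (w ∘ suc) xs))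
        (cong (x * (v 0 + w 0) +_) (weightedSum-+ (v ∘ suc) (w ∘ suc) xs))
  where
  rearrange : ∀ x a b c d → (x * a + c) + (x * b + d) ≡ x * (a + b) + (c + d)
  rearrange = solve-∀

weightedSum-* : ∀ c w xs → weightedSum (λ j → c * w j) xs ≡ c * weightedSum w xs
weightedSum-* c w []       = sym (*-zeroʳ c)
weightedSum-* c w (x ∷ xs) =
  trans (cong (x * (c * w 0) +_) (weightedSum-* c (w ∘ suc) xs))
        (rearrange x c (w 0) (weightedSum (w ∘ suc) xs))
  where
  rearrange : ∀ x c a s → x * (c * a) + c * s ≡ c * (x * a + s)
  rearrange = solve-∀

weightedSum-1 : ∀ xs → weightedSum (λ _ → 1) xs ≡ sum xs
weightedSum-1 []       = refl
weightedSum-1 (x ∷ xs) = cong₂ _+_ (*-identityʳ x) (weightedSum-1 xs)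

oddSum : List ℕ → ℕ
oddSum = weightedSum (λ j → suc (2 * j))

cycAux-2+ : ∀ i xs → cycAux (2 + i) xs ≡ ℤ.- ℤ.+ weightedSum (λ j → suc (2 * (i + j))) xs
cycAux-2+ i []       = refl
cycAux-2+ i (x ∷ xs) = begin
  (ℤ.+ 3 ℤ.- ℤ.+ (2 * (2 + i))) ℤ.* ℤ.+ x ℤ.+ cycAux (3 + i) xs
    ≡⟨ cong₂ (λ c r → c ℤ.* ℤ.+ x ℤ.+ r) (cong (λ n → ℤ.+ 3 ℤ.- ℤ.+ n) (coefficient i)) (cycAux-2+ (suc i) xs) ⟩
  ℤ.- ℤ.+ a ℤ.* ℤ.+ x ℤ.+ ℤ.- ℤ.+ weightedSum (λ j → suc (2 * (suc i + j))) xs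
    ≡⟨ cong (λ s → ℤ.- ℤ.+ a ℤ.* ℤ.+ x ℤ.+ ℤ.- ℤ.+ s) (weightedSum-cong (λ j → cong (suc ∘ (2 *_)) (sym (+-suc i j))) xs) ⟩
  ℤ.- ℤ.+ a ℤ.* ℤ.+ x ℤ.+ ℤ.- ℤ.+ s
    ≡⟨ negate (ℤ.+ a) (ℤ.+ x) (ℤ.+ s) ⟩
  ℤ.- (ℤ.+ x ℤ.* ℤ.+ a ℤ.+ ℤ.+ s)
    ≡⟨ cong (λ t → ℤ.- (t ℤ.+ ℤ.+ s)) (sym (ℤP.pos-* x a)) ⟩
  ℤ.- (ℤ.+ (x * a) ℤ.+ ℤ.+ s)
    ≡⟨ cong ℤ.-_ (sym (ℤP.pos-+ (x * a) s)) ⟩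
  ℤ.- ℤ.+ (x * a + s)
    ∎
  where
  open ≡-Reasoning
  a = suc (2 * (i + 0))
  s = weightedSum (λ j → suc (2 * (i + suc j))) xs
  coefficient : ∀ i → 2 * (2 + i) ≡ 3 + suc (2 * (i + 0))
  coefficient = solve-∀
  negate : ∀ a x s → ℤ.- a ℤ.* x ℤ.+ ℤ.- s ≡ ℤ.- (x ℤ.* a ℤ.+ s)
  negate = ℤSolver.solve-∀

cyclicity-∷ : ∀ n xs → cyclicity (n ∷ xs) ≡ ℤ.+ n ℤ.- ℤ.+ oddSum xs
cyclicity-∷ n xs = cong₂ ℤ._+_ (ℤP.*-identityˡ (ℤ.+ n)) (cycAux-2+ 0 xs)

cyclicity-∷≡0 : ∀ n xs → cyclicity (n ∷ xs) ≡ ℤ.+ 0 → n ≡ oddSum xs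
cyclicity-∷≡0 n xs c≡0 =
  ℤP.+-injective (ℤP.i-j≡0⇒i≡j _ _ (trans (sym (cyclicity-∷ n xs)) c≡0))

cyclicity-oddSum-∷ : ∀ xs → cyclicity (oddSum xs ∷ xs) ≡ ℤ.+ 0
cyclicity-oddSum-∷ xs = trans (cyclicity-∷ _ xs) (ℤP.+-inverseʳ (ℤ.+ oddSum xs))

oddSum+sum : ∀ xs → oddSum xs + sum xs ≡ 2 * weightedSum suc xs
oddSum+sum xs = begin
  oddSum xs + sum xs                   ≡⟨ cong (oddSum xs +_) (sym (weightedSum-1 xs)) ⟩
  oddSum xs + weightedSum (λ _ → 1) xs ≡⟨ weightedSum-+ _ _ xs ⟩
  weightedSum (λ j → suc (2 * j) + 1) xs ≡⟨ weightedSum-cong (λ j → pointwise j) xs ⟩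
  weightedSum (λ j → 2 * suc j) xs     ≡⟨ weightedSum-* 2 suc xs ⟩
  2 * weightedSum suc xs               ∎
  where
  open ≡-Reasoning
  pointwise : ∀ j → 1 + 2 * j + 1 ≡ 2 * (1 + j)
  pointwise = solve-∀

head₀ : List ℕ → ℕ
head₀ []      = 0
head₀ (x ∷ _) = x

head₀-≤ : ∀ {x xs} → Descending (x ∷ xs) → head₀ xs ≤ x
head₀-≤ [-]       = z≤n
head₀-≤ (x≥y ∷ _) = x≥y

descending-∷ : ∀ {x ys} → head₀ ys ≤ x → Descending ys → Descending (x ∷ ys)
descending-∷ {ys = []}    _    _    = [-]
descending-∷ {ys = _ ∷ _} y≤x desc = y≤x ∷ desc

head₀≤sum : ∀ xs → head₀ xs ≤ sum xs
head₀≤sum []       = z≤n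
head₀≤sum (x ∷ xs) = m≤m+n x (sum xs)

zeroCyclicity↔ : ∀ {m} → 1 ≤ m →
  ZeroCyclicityPartition (2 * m) ↔ Σ (List ℕ) (IsPartitionWith (weightedSum suc) m)
zeroCyclicity↔ {m} 1≤m =
  subtype-↔ (×-irrelevant (IsPartitionWith-irrelevant sum) (Decidable⇒UIP.≡-irrelevant ℤ._≟_))
            (IsPartitionWith-irrelevant (weightedSum suc))
            (drop 1) (λ xs _ → oddSum xs ∷ xs) tail-pres cons-pres (λ _ _ → refl) cons-tail
  where

  empty-excluded : 0 ≢ 2 * m
  empty-excluded = <⇒≢ (≤-trans 1≤m (m≤n*m m 2))

  tail-pres : ∀ ps → IsPartition (2 * m) ps × cyclicity ps ≡ ℤ.+ 0 →
              IsPartitionWith (weightedSum suc) m (drop 1 ps)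
  tail-pres []       ((_ , _ , 0≡2m) , _)          = ⊥-elim (empty-excluded 0≡2m)
  tail-pres (n ∷ xs) ((_ ∷ pos , desc , s) , c≡0) = pos , Linked.tail desc , *-cancelˡ-≡ _ _ 2 (begin
    2 * weightedSum suc xs ≡⟨ sym (oddSum+sum xs) ⟩
    oddSum xs + sum xs     ≡⟨ cong (_+ sum xs) (sym (cyclicity-∷≡0 n xs c≡0)) ⟩
    n + sum xs             ≡⟨ s ⟩
    2 * m                  ∎)
    where open ≡-Reasoning

  cons-pres : ∀ xs → IsPartitionWith (weightedSum suc) m xs →
              IsPartition (2 * m) (oddSum xs ∷ xs) × cyclicity (oddSum xs ∷ xs) ≡ ℤ.+ 0
  cons-pres xs (pos , desc , s) =
    (≤-trans 1≤m m≤oddSum ∷ pos , descending-∷ head₀≤oddSum desc , trans (oddSum+sum xs) (cong (2 *_) s)) ,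
    cyclicity-oddSum-∷ xs
    where
    m≤oddSum : m ≤ oddSum xs
    m≤oddSum = subst (_≤ oddSum xs) s (weightedSum-mono-≤ (λ j → s≤s (m≤m+n j (j + 0))) xs)
    head₀≤oddSum : head₀ xs ≤ oddSum xs
    head₀≤oddSum = ≤-trans (head₀≤sum xs)
      (subst (_≤ oddSum xs) (weightedSum-1 xs) (weightedSum-mono-≤ (λ _ → s≤s z≤n) xs))

  cons-tail : ∀ ps → IsPartition (2 * m) ps × cyclicity ps ≡ ℤ.+ 0 → oddSum (drop 1 ps) ∷ drop 1 ps ≡ ps
  cons-tail []       ((_ , _ , 0≡2m) , _) = ⊥-elim (empty-excluded 0≡2m)
  cons-tail (n ∷ xs) (_ , c≡0)            = cong (_∷ xs) (sym (cyclicity-∷≡0 n xs c≡0))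

suffixSums : List ℕ → List ℕ
suffixSums []       = []
suffixSums (x ∷ xs) = x + sum xs ∷ suffixSums xs

differences : List ℕ → List ℕ
differences []       = []
differences (x ∷ xs) = x ∸ head₀ xs ∷ differences xs

LastPositive : List ℕ → Set
LastPositive []           = ⊤
LastPositive (x ∷ [])     = 1 ≤ x
LastPositive (_ ∷ y ∷ ys) = LastPositive (y ∷ ys)

LastPositive-irrelevant : ∀ xs → Irrelevant (LastPositive xs)
LastPositive-irrelevant []           = λ _ _ → refl
LastPositive-irrelevant (_ ∷ [])     = ≤-irrelevant
LastPositive-irrelevant (_ ∷ y ∷ ys) = LastPositive-irrelevant (y ∷ ys)

IsMultiplicityVectorWith : (List ℕ → ℕ) → ℕ → List ℕ → Set
IsMultiplicityVectorWith σ m es = LastPositive es × σ es ≡ m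

IsMultiplicityVectorWith-irrelevant : ∀ σ {m} es → Irrelevant (IsMultiplicityVectorWith σ m es)
IsMultiplicityVectorWith-irrelevant _ es = ×-irrelevant (LastPositive-irrelevant es) ≡-irrelevant

LastPositive-tail : ∀ {x} xs → LastPositive (x ∷ xs) → LastPositive xs
LastPositive-tail []      _ = tt
LastPositive-tail (_ ∷ _) h = h

head₀-suffixSums : ∀ xs → head₀ (suffixSums xs) ≡ sum xs
head₀-suffixSums []      = refl
head₀-suffixSums (_ ∷ _) = refl

differences-suffixSums : ∀ xs → differences (suffixSums xs) ≡ xs
differences-suffixSums []       = refl
differences-suffixSums (x ∷ xs) =
  cong₂ _∷_ (trans (cong (x + sum xs ∸_) (head₀-suffixSums xs)) (m+n∸n≡m x (sum xs)))
            (differences-suffixSums xs)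

sum-differences : ∀ {xs} → Descending xs → sum (differences xs) ≡ head₀ xs
sum-differences {[]}     _    = refl
sum-differences {x ∷ xs} desc =
  trans (cong (x ∸ head₀ xs +_) (sum-differences (Linked.tail desc))) (m∸n+n≡m (head₀-≤ desc))

suffixSums-differences : ∀ {xs} → Descending xs → suffixSums (differences xs) ≡ xs
suffixSums-differences {[]}     _    = refl
suffixSums-differences {_ ∷ _} desc =
  cong₂ _∷_ (sum-differences desc) (suffixSums-differences (Linked.tail desc))

suffixSums-descending : ∀ xs → Descending (suffixSums xs)
suffixSums-descending []       = []
suffixSums-descending (x ∷ xs) =
  descending-∷ (subst (_≤ x + sum xs) (sym (head₀-suffixSums xs)) (m≤n+m (sum xs) x))
               (suffixSums-descending xs)

sum-positive : ∀ x xs → LastPositive (x ∷ xs) → 1 ≤ sum (x ∷ xs)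
sum-positive x []       h = ≤-trans h (m≤m+n x 0)
sum-positive x (y ∷ ys) h = ≤-trans (sum-positive y ys h) (m≤n+m (y + sum ys) x)

suffixSums-positive : ∀ xs → LastPositive xs → Positive (suffixSums xs)
suffixSums-positive []       _ = []
suffixSums-positive (x ∷ xs) h = sum-positive x xs h ∷ suffixSums-positive xs (LastPositive-tail xs h)

differences-LastPositive : ∀ {xs} → Positive xs → LastPositive (differences xs)
differences-LastPositive {[]}        _         = tt
differences-LastPositive {_ ∷ []}    (1≤x ∷ _) = 1≤x
differences-LastPositive {_ ∷ _ ∷ _} (_ ∷ pos) = differences-LastPositive pos

-- Abel summation: Σ_k w_k (Σ_{j ≥ k} e_j) = Σ_j e_j W_j, where W_j = c + Σ_{k ≤ j} w_k.
weightedSum-suffixSums : ∀ {w W} c → W 0 ≡ c + w 0 → (∀ j → W (suc j) ≡ W j + w (suc j)) →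
                         ∀ e → weightedSum w (suffixSums e) + c * sum e ≡ weightedSum W e
weightedSum-suffixSums c _ _ [] = *-zeroʳ c
weightedSum-suffixSums {w} {W} c W₀ Wₛ (x ∷ e) = begin
  ((x + sum e) * w 0 + S) + c * (x + sum e)       ≡⟨ rearrange x (sum e) (w 0) c S ⟩
  x * (c + w 0) + (S + (c + w 0) * sum e)         ≡⟨ cong (λ a → x * a + (S + a * sum e)) (sym W₀) ⟩
  x * W 0 + (S + W 0 * sum e)                     ≡⟨ cong (x * W 0 +_) (weightedSum-suffixSums (W 0) (Wₛ 0) (Wₛ ∘ suc) e) ⟩
  x * W 0 + weightedSum (W ∘ suc) e               ∎
  where
  open ≡-Reasoning
  S = weightedSum (w ∘ suc) (suffixSums e)
  rearrange : ∀ x s a c S → ((x + s) * a + S) + c * (x + s) ≡ x * (c + a) + (S + (c + a) * s)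
  rearrange = solve-∀

weightedSum-suc-suffixSums : ∀ e → weightedSum suc (suffixSums e) ≡ weightedSum (tri ∘ suc) e
weightedSum-suc-suffixSums e =
  trans (sym (+-identityʳ _)) (weightedSum-suffixSums 0 refl (tri-suc ∘ suc) e)

partition↔differenceSequence : ∀ m →
  Σ (List ℕ) (IsPartitionWith (weightedSum suc) m) ↔
  Σ (List ℕ) (IsMultiplicityVectorWith (weightedSum (tri ∘ suc)) m)
partition↔differenceSequence m =
  subtype-↔ (IsPartitionWith-irrelevant (weightedSum suc))
            (λ {es} → IsMultiplicityVectorWith-irrelevant (weightedSum (tri ∘ suc)) es)
            differences (λ e _ → suffixSums e) differences-pres suffixSums-pres
            (λ e _ → differences-suffixSums e) (λ _ (_ , desc , _) → suffixSums-differences desc)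
  where
  differences-pres : ∀ xs → IsPartitionWith (weightedSum suc) m xs →
                     IsMultiplicityVectorWith (weightedSum (tri ∘ suc)) m (differences xs)
  differences-pres xs (pos , desc , s) =
    differences-LastPositive pos ,
    trans (sym (weightedSum-suc-suffixSums (differences xs)))
          (trans (cong (weightedSum suc) (suffixSums-differences desc)) s)

  suffixSums-pres : ∀ e → IsMultiplicityVectorWith (weightedSum (tri ∘ suc)) m e →
                    IsPartitionWith (weightedSum suc) m (suffixSums e)
  suffixSums-pres e (h , s) =
    suffixSums-positive e h , suffixSums-descending e , trans (weightedSum-suc-suffixSums e) s

incrementAt : ℕ → List ℕ → List ℕ
incrementAt zero    []       = 1 ∷ []
incrementAt zero    (y ∷ ys) = suc y ∷ ys
incrementAt (suc k) []       = 0 ∷ incrementAt k []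
incrementAt (suc k) (y ∷ ys) = y ∷ incrementAt k ys

-- Entry k of a multiplicity vector is the number of parts equal to k + 1.
multiplicities : List ℕ → List ℕ
multiplicities []       = []
multiplicities (x ∷ xs) = incrementAt (pred x) (multiplicities xs)

fromMultiplicities : List ℕ → List ℕ
fromMultiplicities []           = []
fromMultiplicities (zero ∷ es)  = map suc (fromMultiplicities es)
fromMultiplicities (suc c ∷ es) = fromMultiplicities (c ∷ es) ++ [ 1 ]

shift : List ℕ → List ℕ
shift []       = []
shift (y ∷ ys) = 0 ∷ y ∷ ys

incrementAt-comm : ∀ i j ys → incrementAt i (incrementAt j ys) ≡ incrementAt j (incrementAt i ys)
incrementAt-comm zero    zero    ys       = refl
incrementAt-comm zero    (suc j) []       = refl
incrementAt-comm zero    (suc j) (_ ∷ _)  = refl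
incrementAt-comm (suc i) zero    []       = refl
incrementAt-comm (suc i) zero    (_ ∷ _)  = refl
incrementAt-comm (suc i) (suc j) []       = cong (0 ∷_) (incrementAt-comm i j [])
incrementAt-comm (suc i) (suc j) (y ∷ ys) = cong (y ∷_) (incrementAt-comm i j ys)

incrementAt-suc-shift : ∀ i ys → incrementAt (suc i) (shift ys) ≡ shift (incrementAt i ys)
incrementAt-suc-shift zero    []      = refl
incrementAt-suc-shift (suc _) []      = refl
incrementAt-suc-shift zero    (_ ∷ _) = refl
incrementAt-suc-shift (suc _) (_ ∷ _) = refl

length-incrementAt : ∀ i ys → length ys ≤ suc i → length (incrementAt i ys) ≡ suc i
length-incrementAt zero    []          _         = refl
length-incrementAt zero    (_ ∷ [])    _         = refl
length-incrementAt zero    (_ ∷ _ ∷ _) (s≤s ())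
length-incrementAt (suc i) []          _         = cong suc (length-incrementAt i [] z≤n)
length-incrementAt (suc i) (_ ∷ ys)    (s≤s len) = cong suc (length-incrementAt i ys len)

LastPositive-∷-incrementAt : ∀ y i ys → LastPositive ys → LastPositive (y ∷ incrementAt i ys)
LastPositive-∷-incrementAt _ zero    []           _ = s≤s z≤n
LastPositive-∷-incrementAt _ zero    (_ ∷ [])     _ = s≤s z≤n
LastPositive-∷-incrementAt _ zero    (_ ∷ _ ∷ _)  h = h
LastPositive-∷-incrementAt _ (suc i) []           h = LastPositive-∷-incrementAt 0 i [] h
LastPositive-∷-incrementAt _ (suc i) (z ∷ zs)     h = LastPositive-∷-incrementAt z i zs (LastPositive-tail zs h)

multiplicities-LastPositive : ∀ as → LastPositive (multiplicities as)
multiplicities-LastPositive []       = tt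
multiplicities-LastPositive (x ∷ as) =
  LastPositive-tail (incrementAt (pred x) (multiplicities as))
    (LastPositive-∷-incrementAt 0 (pred x) (multiplicities as) (multiplicities-LastPositive as))

multiplicities-++-[1] : ∀ as → multiplicities (as ++ [ 1 ]) ≡ incrementAt 0 (multiplicities as)
multiplicities-++-[1] []       = refl
multiplicities-++-[1] (x ∷ as) =
  trans (cong (incrementAt (pred x)) (multiplicities-++-[1] as)) (incrementAt-comm (pred x) 0 (multiplicities as))

multiplicities-map-suc : ∀ {as} → Positive as → multiplicities (map suc as) ≡ shift (multiplicities as)
multiplicities-map-suc {[]}         _         = refl
multiplicities-map-suc {suc x ∷ as} (_ ∷ pos) =
  trans (cong (incrementAt (suc x)) (multiplicities-map-suc pos)) (incrementAt-suc-shift x (multiplicities as))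

length-multiplicities : ∀ {as} → Positive as → Descending as → length (multiplicities as) ≡ head₀ as
length-multiplicities {[]}         _         _    = refl
length-multiplicities {suc x ∷ as} (_ ∷ pos) desc =
  length-incrementAt x (multiplicities as)
    (≤-trans (≤-reflexive (length-multiplicities pos (Linked.tail desc))) (head₀-≤ desc))

fromMultiplicities-singleton-++-[1] : ∀ c → fromMultiplicities [ c ] ++ [ 1 ] ≡ 1 ∷ fromMultiplicities [ c ]
fromMultiplicities-singleton-++-[1] zero    = refl
fromMultiplicities-singleton-++-[1] (suc c) = cong (_++ [ 1 ]) (fromMultiplicities-singleton-++-[1] c)

fromMultiplicities-incrementAt : ∀ i es → length es ≤ suc i →
                                 fromMultiplicities (incrementAt i es) ≡ suc i ∷ fromMultiplicities es
fromMultiplicities-incrementAt zero    []          _         = refl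
fromMultiplicities-incrementAt zero    (c ∷ [])    _         = fromMultiplicities-singleton-++-[1] c
fromMultiplicities-incrementAt zero    (_ ∷ _ ∷ _) (s≤s ())
fromMultiplicities-incrementAt (suc i) []          _         = cong (map suc) (fromMultiplicities-incrementAt i [] z≤n)
fromMultiplicities-incrementAt (suc i) (c ∷ es)    (s≤s len) = lower c
  where
  lower : ∀ c → fromMultiplicities (c ∷ incrementAt i es) ≡ suc (suc i) ∷ fromMultiplicities (c ∷ es)
  lower zero    = cong (map suc) (fromMultiplicities-incrementAt i es len)
  lower (suc c) = cong (_++ [ 1 ]) (lower c)

fromMultiplicities-multiplicities : ∀ {as} → Positive as → Descending as → fromMultiplicities (multiplicities as) ≡ as
fromMultiplicities-multiplicities {[]}         _         _    = refl
fromMultiplicities-multiplicities {suc x ∷ as} (_ ∷ pos) desc = begin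
  fromMultiplicities (incrementAt x (multiplicities as))
    ≡⟨ fromMultiplicities-incrementAt x (multiplicities as) (≤-trans (≤-reflexive (length-multiplicities pos desc′)) (head₀-≤ desc)) ⟩
  suc x ∷ fromMultiplicities (multiplicities as)
    ≡⟨ cong (suc x ∷_) (fromMultiplicities-multiplicities pos desc′) ⟩
  suc x ∷ as
    ∎
  where
  open ≡-Reasoning
  desc′ = Linked.tail desc

fromMultiplicities-positive : ∀ es → Positive (fromMultiplicities es)
fromMultiplicities-positive []           = []
fromMultiplicities-positive (zero ∷ es)  = All.map⁺ (All.universal (λ _ → s≤s z≤n) (fromMultiplicities es))
fromMultiplicities-positive (suc c ∷ es) = All.++⁺ (fromMultiplicities-positive (c ∷ es)) (s≤s z≤n ∷ [])

multiplicities-fromMultiplicities : ∀ es → LastPositive es → multiplicities (fromMultiplicities es) ≡ es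
multiplicities-fromMultiplicities []                 _ = refl
multiplicities-fromMultiplicities (zero ∷ [])        ()
multiplicities-fromMultiplicities (zero ∷ e ∷ es)    h =
  trans (multiplicities-map-suc (fromMultiplicities-positive (e ∷ es)))
        (cong shift (multiplicities-fromMultiplicities (e ∷ es) h))
multiplicities-fromMultiplicities (suc zero ∷ [])    _ = refl
multiplicities-fromMultiplicities (suc (suc c) ∷ []) _ =
  trans (multiplicities-++-[1] (fromMultiplicities [ suc c ]))
        (cong (incrementAt 0) (multiplicities-fromMultiplicities (suc c ∷ []) (s≤s z≤n)))
multiplicities-fromMultiplicities (suc c ∷ e ∷ es)   h =
  trans (multiplicities-++-[1] (fromMultiplicities (c ∷ e ∷ es)))
        (cong (incrementAt 0) (multiplicities-fromMultiplicities (c ∷ e ∷ es) h))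

descending-++-[1] : ∀ {xs} → Positive xs → Descending xs → Descending (xs ++ [ 1 ])
descending-++-[1] {[]}        _           _           = [-]
descending-++-[1] {_ ∷ []}    (1≤x ∷ _)   _           = 1≤x ∷ [-]
descending-++-[1] {_ ∷ _ ∷ _} (_ ∷ pos)   (x≥y ∷ desc) = x≥y ∷ descending-++-[1] pos desc

fromMultiplicities-descending : ∀ es → Descending (fromMultiplicities es)
fromMultiplicities-descending []           = []
fromMultiplicities-descending (zero ∷ es)  = Linked.map⁺ (Linked.map s≤s (fromMultiplicities-descending es))
fromMultiplicities-descending (suc c ∷ es) =
  descending-++-[1] (fromMultiplicities-positive (c ∷ es)) (fromMultiplicities-descending (c ∷ es))

sum-map-fromMultiplicities : ∀ f es → sum (map f (fromMultiplicities es)) ≡ weightedSum (f ∘ suc) es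
sum-map-fromMultiplicities f []           = refl
sum-map-fromMultiplicities f (zero ∷ es)  =
  trans (cong sum (sym (map-∘ (fromMultiplicities es)))) (sum-map-fromMultiplicities (f ∘ suc) es)
sum-map-fromMultiplicities f (suc c ∷ es) = begin
  sum (map f (xs ++ [ 1 ]))                 ≡⟨ cong sum (map-++ f xs [ 1 ]) ⟩
  sum (map f xs ++ [ f 1 ])                 ≡⟨ sum-++ (map f xs) [ f 1 ] ⟩
  sum (map f xs) + (f 1 + 0)                ≡⟨ cong (_+ (f 1 + 0)) (sum-map-fromMultiplicities f (c ∷ es)) ⟩
  (c * f 1 + W) + (f 1 + 0)                 ≡⟨ rearrange c (f 1) W ⟩
  suc c * f 1 + W                           ∎
  where
  open ≡-Reasoning
  xs = fromMultiplicities (c ∷ es)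
  W  = weightedSum (f ∘ suc ∘ suc) es
  rearrange : ∀ c a w → (c * a + w) + (a + 0) ≡ (1 + c) * a + w
  rearrange = solve-∀

multiplicityVector↔partition : ∀ f m →
  Σ (List ℕ) (IsMultiplicityVectorWith (weightedSum (f ∘ suc)) m) ↔
  Σ (List ℕ) (IsPartitionWith (sum ∘ map f) m)
multiplicityVector↔partition f m =
  subtype-↔ (λ {es} → IsMultiplicityVectorWith-irrelevant (weightedSum (f ∘ suc)) es)
            (IsPartitionWith-irrelevant (sum ∘ map f))
            fromMultiplicities (λ as _ → multiplicities as) fromMultiplicities-pres multiplicities-pres
            (λ _ (pos , desc , _) → fromMultiplicities-multiplicities pos desc)
            (λ es (h , _) → multiplicities-fromMultiplicities es h)
  where
  fromMultiplicities-pres : ∀ es → IsMultiplicityVectorWith (weightedSum (f ∘ suc)) m es →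
                            IsPartitionWith (sum ∘ map f) m (fromMultiplicities es)
  fromMultiplicities-pres es (_ , s) =
    fromMultiplicities-positive es , fromMultiplicities-descending es , trans (sum-map-fromMultiplicities f es) s

  multiplicities-pres : ∀ as → IsPartitionWith (sum ∘ map f) m as →
                        IsMultiplicityVectorWith (weightedSum (f ∘ suc)) m (multiplicities as)
  multiplicities-pres as (pos , desc , s) =
    multiplicities-LastPositive as ,
    trans (sym (sum-map-fromMultiplicities f (multiplicities as)))
          (trans (cong (sum ∘ map f) (fromMultiplicities-multiplicities pos desc)) s)

indices : ∀ {ps} → All Triangular ps → List ℕ
indices = All.reduce proj₁

map-tri-indices : ∀ {ps} (tr : All Triangular ps) → map tri (indices tr) ≡ ps
map-tri-indices []                  = refl
map-tri-indices ((_ , _ , x≡) ∷ tr) = cong₂ _∷_ (sym x≡) (map-tri-indices tr)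

indices-map-tri : ∀ as (tr : All Triangular (map tri as)) → indices tr ≡ as
indices-map-tri []       []                 = refl
indices-map-tri (a ∷ as) ((_ , _ , e) ∷ tr) = cong₂ _∷_ (tri-injective (sym e)) (indices-map-tri as tr)

indices-positive : ∀ {ps} (tr : All Triangular ps) → Positive (indices tr)
indices-positive []                   = []
indices-positive ((_ , 1≤i , _) ∷ tr) = 1≤i ∷ indices-positive tr

indices-descending : ∀ {ps} (tr : All Triangular ps) → Descending ps → Descending (indices tr)
indices-descending tr desc =
  Linked.map tri-cancel-≤ (Linked.map⁻ {f = tri} (subst Descending (sym (map-tri-indices tr)) desc))

indexPartition↔triangularPartition : ∀ m →
  Σ (List ℕ) (IsPartitionWith (sum ∘ map tri) m) ↔ TriangularPartition m
indexPartition↔triangularPartition m =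
  subtype-↔ (IsPartitionWith-irrelevant (sum ∘ map tri))
            (×-irrelevant (IsPartitionWith-irrelevant sum) (All.irrelevant Triangular-irrelevant))
            (map tri) (λ _ (_ , tr) → indices tr) map-tri-pres indices-pres
            (λ _ (_ , tr) → map-tri-indices tr) (λ as _ → indices-map-tri as _)
  where
  map-tri-pres : ∀ as → IsPartitionWith (sum ∘ map tri) m as →
                 IsPartition m (map tri as) × All Triangular (map tri as)
  map-tri-pres as (pos , desc , s) =
    (All.map⁺ (All.map tri-< pos) , Linked.map⁺ (Linked.map tri-mono-≤ desc) , s) ,
    All.map⁺ (All.map (λ {i} 1≤i → i , 1≤i , refl) pos)

  indices-pres : ∀ ps (q : IsPartition m ps × All Triangular ps) →
                 IsPartitionWith (sum ∘ map tri) m (indices (proj₂ q))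
  indices-pres ps ((_ , desc , s) , tr) =
    indices-positive tr , indices-descending tr desc , trans (cong sum (map-tri-indices tr)) s

theorem1p2 : (m : ℕ) → 1 ≤ m → ZeroCyclicityPartition (2 * m) ↔ TriangularPartition m
theorem1p2 m 1≤m =
  ↔-trans (zeroCyclicity↔ 1≤m)
    (↔-trans (partition↔differenceSequence m)
      (↔-trans (multiplicityVector↔partition tri m)
        (indexPartition↔triangularPartition m)))
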